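{- Let $p,q$ be real numbers such that the sequence $n_{\mathcal T}=\sum_{i=1}^{n}q^{n-i}p^{i-1}$ ($n\ge 1$) consists of positive integers, with associated $\mathcal T$-nomial coefficients $\binom{n}{k}_{\mathcal T}$. For every integer $n\ge 1$, as polynomials in $x$, $$\sum_{k\ge 0}(-1)^k q^{\binom{k}{2}}p^{\binom{n-k}{2}}\binom{n}{k}_{\mathcal T}x^k=\prod_{i=1}^{n}\bigl(p^{i-1}-q^{i-1}x\bigr).$$
   Context: Let $p,q\in\mathbb R$. The sequence $\mathcal T=(n_{\mathcal T})_{n\ge1}$ is defined by $n_{\mathcal T}=[x^n]\,\frac{x}{(1-px)(1-qx)}=\sum_{i=1}^{n}q^{n-i}p^{i-1}$; it is assumed that every $n_{\mathcal T}$ is a positive integer. Put $n_{\mathcal T}!=n_{\mathcal T}(n-1)_{\mathcal T}\cdots 1_{\mathcal T}$, $0_{\mathcal T}!=1$, and for integers $0\le k\le n$ define $\binom{n}{k}_{\mathcal T}=\frac{n_{\mathcal T}!}{k_{\mathcal T}!\,(n-k)_{\mathcal T}!}$; set $\binom{n}{k}_{\mathcal T}=0$ for $k>n$. Here $\binom{m}{2}=m(m-1)/2$. -}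

module Defs where

open import Level using (Level)
open import Data.Nat using (ℕ; zero; suc; _∸_)
open import Data.List using (List; []; _∷_; map)
open import Algebra.Apartness.Bundles using (HeytingField)

-- All notions are defined relative to an arbitrary Heyting field F
-- (the constructive notion of field with apartness; ℝ is one).
module TDefs {c ℓ₁ ℓ₂ : Level} (F : HeytingField c ℓ₁ ℓ₂) where
  open HeytingField F

  natF : ℕ → Carrier
  natF zero    = 0#
  natF (suc m) = 1# + natF m

  pow : Carrier → ℕ → Carrier
  pow x zero    = 1#
  pow x (suc m) = x * pow x m

  sumTo : ℕ → (ℕ → Carrier) → Carrier
  sumTo zero    f = 0#
  sumTo (suc n) f = sumTo n f + f (suc n)

  tnum : Carrier → Carrier → ℕ → Carrier
  tnum p q n = sumTo n (λ i → pow q (n ∸ i) * pow p (i ∸ 1))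

  tfact : Carrier → Carrier → ℕ → Carrier
  tfact p q zero    = 1#
  tfact p q (suc n) = tnum p q (suc n) * tfact p q n

  -- polynomials in x as coefficient lists (constant term first)
  Poly : Set c
  Poly = List Carrier

  addP : Poly → Poly → Poly
  addP []       g        = g
  addP (a ∷ f)  []       = a ∷ f
  addP (a ∷ f)  (b ∷ g)  = (a + b) ∷ addP f g

  mulP : Poly → Poly → Poly
  mulP []      g = []
  mulP (a ∷ f) g = addP (map (a *_) g) (0# ∷ mulP f g)

  coeff : Poly → ℕ → Carrier
  coeff []      k       = 0#
  coeff (a ∷ f) zero    = a
  coeff (a ∷ f) (suc k) = coeff f k

  prodP : Carrier → Carrier → ℕ → Poly
  prodP p q zero    = 1# ∷ []
  prodP p q (suc n) = mulP (prodP p q n) (pow p n ∷ (- pow q n) ∷ [])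

-- Multiplying ∏_{i≤n} (p^{i-1} - q^{i-1} x) by p^n - q^n x gives the coefficient recurrence
-- c_{n+1,k} = p^n c_{n,k} - q^n c_{n,k-1}, so it suffices that the left-hand coefficients obey
-- it too. Away from the boundary k ∈ {0, n+1} this is the T-Pascal rule
-- binom(n+1, k) = p^k binom(n, k) + q^{n+1-k} binom(n, k-1), which comes from the addition
-- formula (k+l)_T = p^k l_T + q^l k_T after cancelling factorials; the factorials are
-- invertible because the n_T are positive integers in a field of characteristic zero.
module Submission where

open import Defs
open import Level using (Level)
open import Data.Nat using (ℕ; zero; suc; _∸_; _≤_; _<_; z≤n; s≤s) renaming (_+_ to _+ℕ_)
import Data.Nat.Properties as ℕₚ
open import Data.Nat.Combinatorics using (_C_; nCk+nC[k+1]≡[n+1]C[k+1]; nC1≡n)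
open import Data.Product using (∃-syntax; _×_; _,_)
open import Data.List using ([]; _∷_)
open import Relation.Binary.PropositionalEquality using (_≡_; cong)
  renaming (refl to ≡-refl; sym to ≡-sym; trans to ≡-trans)
open import Relation.Binary.Definitions using (tri<; tri≈; tri>)
open import Algebra.Apartness.Bundles using (HeytingField; HeytingCommutativeRing)
open import Algebra.Bundles using (CommutativeRing)
import Algebra.Definitions
import Algebra.Properties.Ring
import Algebra.Solver.Ring.NaturalCoefficients.Default
import Relation.Binary.Reasoning.Setoid

[1+n]C2≡nC2+n : ∀ n → suc n C 2 ≡ n C 2 +ℕ n
[1+n]C2≡nC2+n n = ≡-trans (≡-sym (nCk+nC[k+1]≡[n+1]C[k+1] n 1))
                          (≡-trans (cong (_+ℕ n C 2) (nC1≡n n)) (ℕₚ.+-comm n (n C 2)))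

module _ {c ℓ₁ ℓ₂ : Level} (F : HeytingField c ℓ₁ ℓ₂) where
  open HeytingField F hiding (zero)
  open TDefs F

  private
    commutativeRing : CommutativeRing c ℓ₁
    commutativeRing = HeytingCommutativeRing.commutativeRing heytingCommutativeRing

  open Algebra.Definitions _≈_ using (LeftInvertible)
  open Algebra.Properties.Ring (CommutativeRing.ring commutativeRing)
    using (-1*x≈-x; -0#≈0#; -‿distribʳ-*)
  open Algebra.Solver.Ring.NaturalCoefficients.Default
    (CommutativeRing.commutativeSemiring commutativeRing)
  open Relation.Binary.Reasoning.Setoid setoid

  x≈0⇒x*y-z≈-z : ∀ {x} y z → x ≈ 0# → x * y - z ≈ - z
  x≈0⇒x*y-z≈-z y z x≈0 = trans (+-congʳ (trans (*-congʳ x≈0) (zeroˡ y))) (+-identityˡ (- z))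

  pow-+ : ∀ x m n → pow x (m +ℕ n) ≈ pow x m * pow x n
  pow-+ x zero    n = sym (*-identityˡ _)
  pow-+ x (suc m) n = trans (*-congˡ (pow-+ x m n)) (sym (*-assoc _ _ _))

  pow-[1+n]C2 : ∀ x n → pow x (suc n C 2) ≈ pow x (n C 2) * pow x n
  pow-[1+n]C2 x n = trans (reflexive (cong (pow x) ([1+n]C2≡nC2+n n))) (pow-+ x (n C 2) n)

  sumTo-cong : ∀ n {f g} → (∀ i → i ≤ n → f i ≈ g i) → sumTo n f ≈ sumTo n g
  sumTo-cong zero    f≈g = refl
  sumTo-cong (suc n) f≈g =
    +-cong (sumTo-cong n (λ i i≤n → f≈g i (ℕₚ.m≤n⇒m≤1+n i≤n))) (f≈g (suc n) ℕₚ.≤-refl)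

  sumTo-*ˡ : ∀ n x f → sumTo n (λ i → x * f i) ≈ x * sumTo n f
  sumTo-*ˡ zero    x f = sym (zeroʳ x)
  sumTo-*ˡ (suc n) x f = trans (+-congʳ (sumTo-*ˡ n x f)) (sym (distribˡ x _ _))

  coeff-addP : ∀ f g k → coeff (addP f g) k ≈ coeff f k + coeff g k
  coeff-addP []      g       k       = sym (+-identityˡ _)
  coeff-addP (a ∷ f) []      k       = sym (+-identityʳ _)
  coeff-addP (a ∷ f) (b ∷ g) zero    = refl
  coeff-addP (a ∷ f) (b ∷ g) (suc k) = coeff-addP f g k

  coeff-mulP-linear-zero : ∀ f a b → coeff (mulP f (a ∷ b ∷ [])) 0 ≈ coeff f 0 * a
  coeff-mulP-linear-zero []      a b = sym (zeroˡ a)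
  coeff-mulP-linear-zero (x ∷ f) a b = +-identityʳ (x * a)

  coeff-mulP-linear-suc : ∀ f a b k →
    coeff (mulP f (a ∷ b ∷ [])) (suc k) ≈ coeff f (suc k) * a + coeff f k * b
  coeff-mulP-linear-suc []      a b k = sym (trans (+-cong (zeroˡ a) (zeroˡ b)) (+-identityˡ 0#))
  coeff-mulP-linear-suc (x ∷ f) a b zero = begin
    coeff (addP (x * b ∷ []) (mulP f (a ∷ b ∷ []))) 0  ≈⟨ coeff-addP (x * b ∷ []) (mulP f (a ∷ b ∷ [])) 0 ⟩
    x * b + coeff (mulP f (a ∷ b ∷ [])) 0              ≈⟨ +-congˡ (coeff-mulP-linear-zero f a b) ⟩
    x * b + coeff f 0 * a                              ≈⟨ +-comm _ _ ⟩
    coeff f 0 * a + x * b                              ∎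
  coeff-mulP-linear-suc (x ∷ f) a b (suc k) = begin
    coeff (addP (x * b ∷ []) (mulP f (a ∷ b ∷ []))) (suc k)  ≈⟨ coeff-addP (x * b ∷ []) (mulP f (a ∷ b ∷ [])) (suc k) ⟩
    0# + coeff (mulP f (a ∷ b ∷ [])) (suc k)                 ≈⟨ +-identityˡ _ ⟩
    coeff (mulP f (a ∷ b ∷ [])) (suc k)                      ≈⟨ coeff-mulP-linear-suc f a b k ⟩
    coeff f (suc k) * a + coeff f k * b                      ∎

  *-invertible : ∀ {x y} → LeftInvertible 1# _*_ x → LeftInvertible 1# _*_ y →
                 LeftInvertible 1# _*_ (x * y)
  *-invertible {x} {y} (u , u*x≈1) (v , v*y≈1) = v * u , (begin
    v * u * (x * y)    ≈⟨ solve 4 (λ u v x y → v :* u :* (x :* y) := (u :* x) :* (v :* y)) refl u v x y ⟩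
    (u * x) * (v * y)  ≈⟨ *-cong u*x≈1 v*y≈1 ⟩
    1# * 1#            ≈⟨ *-identityˡ 1# ⟩
    1#                 ∎)

  *-cancelʳ-invertible : ∀ {t} → LeftInvertible 1# _*_ t → ∀ {x y} → x * t ≈ y * t → x ≈ y
  *-cancelʳ-invertible {t} (u , u*t≈1) {x} {y} x*t≈y*t = begin
    x              ≈⟨ *-identityʳ x ⟨
    x * 1#         ≈⟨ *-congˡ u*t≈1 ⟨
    x * (u * t)    ≈⟨ solve 3 (λ x u t → x :* (u :* t) := (x :* t) :* u) refl x u t ⟩
    (x * t) * u    ≈⟨ *-congʳ x*t≈y*t ⟩
    (y * t) * u    ≈⟨ solve 3 (λ y u t → (y :* t) :* u := y :* (u :* t)) refl y u t ⟩
    y * (u * t)    ≈⟨ *-congˡ u*t≈1 ⟩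
    y * 1#         ≈⟨ *-identityʳ y ⟩
    y              ∎

  natF-suc-invertible : (∀ m → natF (suc m) # 0#) → ∀ m → LeftInvertible 1# _*_ (natF (suc m))
  natF-suc-invertible char0 m with #⇒invertible (char0 m)
  ... | u , u*[x-0]≈1 , _ = u , trans (*-congˡ (sym x-0≈x)) u*[x-0]≈1
    where
    x-0≈x : natF (suc m) - 0# ≈ natF (suc m)
    x-0≈x = trans (+-congˡ -0#≈0#) (+-identityʳ _)

  module _ (p q : Carrier) where

    tnum-suc : ∀ n → tnum p q (suc n) ≈ q * tnum p q n + pow p n
    tnum-suc n = begin
      sumTo n (λ i → pow q (suc n ∸ i) * pow p (i ∸ 1)) + pow q (n ∸ n) * pow p n
        ≈⟨ +-cong (sumTo-cong n (λ i i≤n → *-congʳ (reflexive (cong (pow q) (ℕₚ.+-∸-assoc 1 i≤n)))))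
                  (*-congʳ (reflexive (cong (pow q) (ℕₚ.n∸n≡0 n)))) ⟩
      sumTo n (λ i → q * pow q (n ∸ i) * pow p (i ∸ 1)) + 1# * pow p n
        ≈⟨ +-cong (sumTo-cong n (λ i _ → *-assoc _ _ _)) (*-identityˡ _) ⟩
      sumTo n (λ i → q * (pow q (n ∸ i) * pow p (i ∸ 1))) + pow p n
        ≈⟨ +-congʳ (sumTo-*ˡ n q _) ⟩
      q * tnum p q n + pow p n
        ∎

    -- n_T is symmetric in p and q, so it also unfolds with their roles exchanged.
    tnum-suc-swap : ∀ n → tnum p q (suc n) ≈ p * tnum p q n + pow q n
    tnum-suc-swap zero = trans (tnum-suc 0)
      (solve 2 (λ p q → q :* con 0 :+ con 1 := p :* con 0 :+ con 1) refl p q)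
    tnum-suc-swap (suc n) = begin
      tnum p q (2 +ℕ n)                     ≈⟨ tnum-suc (suc n) ⟩
      q * tnum p q (suc n) + p * pow p n    ≈⟨ +-congʳ (*-congˡ (tnum-suc-swap n)) ⟩
      q * (p * t + pow q n) + p * pow p n
        ≈⟨ solve 5 (λ p q t a b → q :* (p :* t :+ b) :+ p :* a := p :* (q :* t :+ a) :+ q :* b)
                   refl p q t (pow p n) (pow q n) ⟩
      p * (q * t + pow p n) + q * pow q n   ≈⟨ +-congʳ (*-congˡ (tnum-suc n)) ⟨
      p * tnum p q (suc n) + q * pow q n    ∎
      where t = tnum p q n

    tnum-+ : ∀ k l → tnum p q (k +ℕ l) ≈ pow p k * tnum p q l + pow q l * tnum p q k
    tnum-+ zero l = solve 2 (λ t x → t := con 1 :* t :+ x :* con 0) refl (tnum p q l) (pow q l)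
    tnum-+ (suc k) l = begin
      tnum p q (suc (k +ℕ l))                                ≈⟨ tnum-suc-swap (k +ℕ l) ⟩
      p * tnum p q (k +ℕ l) + pow q (k +ℕ l)                 ≈⟨ +-cong (*-congˡ (tnum-+ k l)) (pow-+ q k l) ⟩
      p * (pow p k * tₗ + pow q l * tₖ) + pow q k * pow q l
        ≈⟨ solve 6 (λ p pk tl ql tk qk → p :* (pk :* tl :+ ql :* tk) :+ qk :* ql
                                       := p :* pk :* tl :+ ql :* (p :* tk :+ qk))
                   refl p (pow p k) tₗ (pow q l) tₖ (pow q k) ⟩
      p * pow p k * tₗ + pow q l * (p * tₖ + pow q k)        ≈⟨ +-congˡ (*-congˡ (tnum-suc-swap k)) ⟨
      pow p (suc k) * tₗ + pow q l * tnum p q (suc k)        ∎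
      where
      tₖ = tnum p q k
      tₗ = tnum p q l

    coeff-prodP-suc-zero : ∀ n → coeff (prodP p q (suc n)) 0 ≈ coeff (prodP p q n) 0 * pow p n
    coeff-prodP-suc-zero n = coeff-mulP-linear-zero (prodP p q n) (pow p n) (- pow q n)

    coeff-prodP-suc : ∀ n k → coeff (prodP p q (suc n)) (suc k)
                              ≈ coeff (prodP p q n) (suc k) * pow p n - coeff (prodP p q n) k * pow q n
    coeff-prodP-suc n k = trans (coeff-mulP-linear-suc (prodP p q n) (pow p n) (- pow q n) k)
                                (+-congˡ (sym (-‿distribʳ-* _ _)))

  module Coefficients
    (char0 : ∀ m → natF (suc m) # 0#)
    (p q : Carrier)
    (tnum-positive : ∀ n → 1 ≤ n → ∃[ m ] (1 ≤ m × tnum p q n ≈ natF m))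
    (binomT : ℕ → ℕ → Carrier)
    (binomT-spec : ∀ n k → k ≤ n → binomT n k * (tfact p q k * tfact p q (n ∸ k)) ≈ tfact p q n)
    (binomT-above : ∀ n k → n < k → binomT n k ≈ 0#)
    where

    tnum-invertible : ∀ n → 1 ≤ n → LeftInvertible 1# _*_ (tnum p q n)
    tnum-invertible n 1≤n with tnum-positive n 1≤n
    ... | suc m , _ , tₙ≈m with natF-suc-invertible char0 m
    ...   | u , u*m≈1 = u , trans (*-congˡ tₙ≈m) u*m≈1

    tfact-invertible : ∀ n → LeftInvertible 1# _*_ (tfact p q n)
    tfact-invertible zero    = 1# , *-identityˡ 1#
    tfact-invertible (suc n) = *-invertible (tnum-invertible (suc n) (s≤s z≤n)) (tfact-invertible n)

    binomT-split : ∀ {n k d} → k +ℕ d ≡ n → binomT n k * (tfact p q k * tfact p q d) ≈ tfact p q n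
    binomT-split {k = k} {d} ≡-refl with binomT-spec (k +ℕ d) k (ℕₚ.m≤m+n k d)
    ... | spec rewrite ℕₚ.m+n∸m≡n k d = spec

    binomT-unique : ∀ {n k d x} → k +ℕ d ≡ n →
                    x * (tfact p q k * tfact p q d) ≈ tfact p q n → binomT n k ≈ x
    binomT-unique {k = k} {d} k+d≡n x*k!d!≈n! =
      *-cancelʳ-invertible (*-invertible (tfact-invertible k) (tfact-invertible d))
                           (trans (binomT-split k+d≡n) (sym x*k!d!≈n!))

    binomT-0 : ∀ n → binomT n 0 ≈ 1#
    binomT-0 n = binomT-unique ≡-refl (trans (*-identityˡ _) (*-identityˡ _))

    binomT-diag : ∀ n → binomT n n ≈ 1#
    binomT-diag n = binomT-unique (ℕₚ.+-identityʳ n)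
      (solve 1 (λ x → con 1 :* (x :* con 1) := x) refl (tfact p q n))

    binomT-pascal : ∀ j r → let n = suc j +ℕ r in
      binomT (suc n) (suc j) ≈ pow p (suc j) * binomT n (suc j) + pow q (suc r) * binomT n j
    binomT-pascal j r = binomT-unique (cong suc (ℕₚ.+-suc j r)) (begin
      (pⱼ * B₁ + qᵣ * B₂) * (tⱼ * Fⱼ * (tᵣ * Fᵣ))
        ≈⟨ solve 8 (λ pj qr B₁ B₂ tj tr Fj Fr
                    → (pj :* B₁ :+ qr :* B₂) :* (tj :* Fj :* (tr :* Fr))
                    := pj :* tr :* (B₁ :* (tj :* Fj :* Fr)) :+ qr :* tj :* (B₂ :* (Fj :* (tr :* Fr))))
                   refl pⱼ qᵣ B₁ B₂ tⱼ tᵣ Fⱼ Fᵣ ⟩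
      pⱼ * tᵣ * (B₁ * (tⱼ * Fⱼ * Fᵣ)) + qᵣ * tⱼ * (B₂ * (Fⱼ * (tᵣ * Fᵣ)))
        ≈⟨ +-cong (*-congˡ (binomT-split ≡-refl)) (*-congˡ (binomT-split (ℕₚ.+-suc j r))) ⟩
      pⱼ * tᵣ * Fₙ + qᵣ * tⱼ * Fₙ
        ≈⟨ distribʳ Fₙ _ _ ⟨
      (pⱼ * tᵣ + qᵣ * tⱼ) * Fₙ
        ≈⟨ *-congʳ (trans (reflexive (cong (tnum p q) (≡-sym (cong suc (ℕₚ.+-suc j r))))) (tnum-+ p q (suc j) (suc r))) ⟨
      tnum p q (suc n) * Fₙ
        ∎)
      where
      n = suc j +ℕ r
      pⱼ = pow p (suc j)
      qᵣ = pow q (suc r)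
      B₁ = binomT n (suc j)
      B₂ = binomT n j
      tⱼ = tnum p q (suc j)
      tᵣ = tnum p q (suc r)
      Fⱼ = tfact p q j
      Fᵣ = tfact p q r
      Fₙ = tfact p q n

    lhs : ℕ → ℕ → Carrier
    lhs n k = pow (- 1#) k * pow q (k C 2) * pow p ((n ∸ k) C 2) * binomT n k

    lhs-above : ∀ {n k} → n < k → lhs n k ≈ 0#
    lhs-above {n} {k} n<k = trans (*-congˡ (binomT-above n k n<k)) (zeroʳ _)

    lhs≈coeff-prodP-zero : ∀ k → lhs 0 k ≈ coeff (prodP p q 0) k
    lhs≈coeff-prodP-zero zero    = trans (*-congˡ (binomT-0 0))
                             (solve 0 (con 1 :* con 1 :* con 1 :* con 1 := con 1) refl)
    lhs≈coeff-prodP-zero (suc k) = lhs-above (s≤s z≤n)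

    lhs-suc-zero : ∀ n → lhs (suc n) 0 ≈ lhs n 0 * pow p n
    lhs-suc-zero n = begin
      1# * 1# * pow p (suc n C 2) * binomT (suc n) 0
        ≈⟨ *-cong (*-congˡ (pow-[1+n]C2 p n)) (binomT-0 (suc n)) ⟩
      1# * 1# * (P * pow p n) * 1#
        ≈⟨ solve 2 (λ P x → con 1 :* con 1 :* (P :* x) :* con 1 := con 1 :* con 1 :* P :* con 1 :* x)
                   refl P (pow p n) ⟩
      1# * 1# * P * 1# * pow p n
        ≈⟨ *-congʳ (*-congˡ (binomT-0 n)) ⟨
      lhs n 0 * pow p n
        ∎
      where P = pow p (n C 2)

    lhs-suc-below : ∀ j r → let n = suc j +ℕ r in
      lhs (suc n) (suc j) ≈ lhs n (suc j) * pow p n - lhs n j * pow q n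
    lhs-suc-below j r = begin
      m * s * pow q (suc j C 2) * pow p ((n ∸ j) C 2) * binomT (suc n) (suc j)
        ≈⟨ *-cong (*-cong (*-congˡ (pow-[1+n]C2 q j)) (pow-p-C2-of-1+r n∸j≡1+r)) (binomT-pascal j r) ⟩
      A * (pow p (suc j) * B₁ + pow q (suc r) * B₂)
        ≈⟨ distribˡ A _ _ ⟩
      A * (pow p (suc j) * B₁) + A * (pow q (suc r) * B₂)
        ≈⟨ +-cong term₁ term₂ ⟩
      lhs n (suc j) * pow p n - lhs n j * pow q n
        ∎
      where
      n = suc j +ℕ r
      m = - 1#
      s = pow m j
      Q = pow q (j C 2)
      P = pow p (r C 2)
      B₁ = binomT n (suc j)
      B₂ = binomT n j
      A = m * s * (Q * pow q j) * (P * pow p r)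
      n∸j≡1+r : n ∸ j ≡ suc r
      n∸j≡1+r = ≡-trans (cong (_∸ j) (≡-sym (ℕₚ.+-suc j r))) (ℕₚ.m+n∸m≡n j (suc r))
      pow-p-C2-of-1+r : ∀ {a} → a ≡ suc r → pow p (a C 2) ≈ P * pow p r
      pow-p-C2-of-1+r ≡-refl = pow-[1+n]C2 p r
      term₁ : A * (pow p (suc j) * B₁) ≈ lhs n (suc j) * pow p n
      term₁ = begin
        A * (pow p (suc j) * B₁)
          ≈⟨ solve 8 (λ m s Q qj P pr pj B → m :* s :* (Q :* qj) :* (P :* pr) :* (pj :* B)
                                          := m :* s :* (Q :* qj) :* P :* B :* (pj :* pr))
                     refl m s Q (pow q j) P (pow p r) (pow p (suc j)) B₁ ⟩
        m * s * (Q * pow q j) * P * B₁ * (pow p (suc j) * pow p r)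
          ≈⟨ *-cong (*-congʳ (*-cong (*-congˡ (pow-[1+n]C2 q j))
                                     (reflexive (cong (λ d → pow p (d C 2)) (ℕₚ.m+n∸m≡n j r)))))
                    (pow-+ p (suc j) r) ⟨
        lhs n (suc j) * pow p n
          ∎
      term₂ : A * (pow q (suc r) * B₂) ≈ - (lhs n j * pow q n)
      term₂ = begin
        A * (pow q (suc r) * B₂)
          ≈⟨ solve 8 (λ m s Q qj P pr qR B → m :* s :* (Q :* qj) :* (P :* pr) :* (qR :* B)
                                          := m :* (s :* Q :* (P :* pr) :* B :* (qj :* qR)))
                     refl m s Q (pow q j) P (pow p r) (pow q (suc r)) B₂ ⟩
        m * (s * Q * (P * pow p r) * B₂ * (pow q j * pow q (suc r)))
          ≈⟨ -1*x≈-x _ ⟩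
        - (s * Q * (P * pow p r) * B₂ * (pow q j * pow q (suc r)))
          ≈⟨ -‿cong (*-cong (*-congʳ (*-congˡ (pow-p-C2-of-1+r n∸j≡1+r)))
                            (trans (reflexive (cong (pow q) (≡-sym (ℕₚ.+-suc j r)))) (pow-+ q j (suc r)))) ⟨
        - (lhs n j * pow q n)
          ∎

    lhs-suc-diag : ∀ n → lhs (suc n) (suc n) ≈ lhs n (suc n) * pow p n - lhs n n * pow q n
    lhs-suc-diag n = begin
      m * s * pow q (suc n C 2) * P₀ * binomT (suc n) (suc n)
        ≈⟨ *-cong (*-congʳ (*-congˡ (pow-[1+n]C2 q n))) (binomT-diag (suc n)) ⟩
      m * s * (Q * pow q n) * P₀ * 1#
        ≈⟨ solve 5 (λ m s Q qn P → m :* s :* (Q :* qn) :* P :* con 1 := m :* (s :* Q :* P :* con 1 :* qn))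
                   refl m s Q (pow q n) P₀ ⟩
      m * (s * Q * P₀ * 1# * pow q n)
        ≈⟨ -1*x≈-x _ ⟩
      - (s * Q * P₀ * 1# * pow q n)
        ≈⟨ -‿cong (*-congʳ (*-congˡ (binomT-diag n))) ⟨
      - (lhs n n * pow q n)
        ≈⟨ x≈0⇒x*y-z≈-z (pow p n) _ (lhs-above (ℕₚ.n<1+n n)) ⟨
      lhs n (suc n) * pow p n - lhs n n * pow q n
        ∎
      where
      m = - 1#
      s = pow m n
      Q = pow q (n C 2)
      P₀ = pow p ((n ∸ n) C 2)

    lhs-suc-above : ∀ {n k} → n < k → lhs (suc n) (suc k) ≈ lhs n (suc k) * pow p n - lhs n k * pow q n
    lhs-suc-above {n} {k} n<k = begin
      lhs (suc n) (suc k)                          ≈⟨ lhs-above (s≤s n<k) ⟩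
      0#                                           ≈⟨ -0#≈0# ⟨
      - 0#                                         ≈⟨ -‿cong (zeroˡ (pow q n)) ⟨
      - (0# * pow q n)                             ≈⟨ -‿cong (*-congʳ (lhs-above n<k)) ⟨
      - (lhs n k * pow q n)                        ≈⟨ x≈0⇒x*y-z≈-z (pow p n) _ (lhs-above (ℕₚ.<-trans n<k (ℕₚ.n<1+n k))) ⟨
      lhs n (suc k) * pow p n - lhs n k * pow q n  ∎

    lhs-suc : ∀ n k → lhs (suc n) (suc k) ≈ lhs n (suc k) * pow p n - lhs n k * pow q n
    lhs-suc n k with ℕₚ.<-cmp k n
    ... | tri< k<n _ _ with ℕₚ.m≤n⇒∃[o]m+o≡n k<n
    ...   | r , ≡-refl = lhs-suc-below k r
    lhs-suc n k | tri≈ _ ≡-refl _ = lhs-suc-diag n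
    lhs-suc n k | tri> _ _ n<k = lhs-suc-above n<k

    lhs≈coeff-prodP : ∀ n k → lhs n k ≈ coeff (prodP p q n) k
    lhs≈coeff-prodP zero    k    = lhs≈coeff-prodP-zero k
    lhs≈coeff-prodP (suc n) zero = begin
      lhs (suc n) 0                      ≈⟨ lhs-suc-zero n ⟩
      lhs n 0 * pow p n                  ≈⟨ *-congʳ (lhs≈coeff-prodP n 0) ⟩
      coeff (prodP p q n) 0 * pow p n    ≈⟨ coeff-prodP-suc-zero p q n ⟨
      coeff (prodP p q (suc n)) 0        ∎
    lhs≈coeff-prodP (suc n) (suc k) = begin
      lhs (suc n) (suc k)
        ≈⟨ lhs-suc n k ⟩
      lhs n (suc k) * pow p n - lhs n k * pow q n
        ≈⟨ +-cong (*-congʳ (lhs≈coeff-prodP n (suc k))) (-‿cong (*-congʳ (lhs≈coeff-prodP n k))) ⟩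
      coeff (prodP p q n) (suc k) * pow p n - coeff (prodP p q n) k * pow q n
        ≈⟨ coeff-prodP-suc p q n k ⟨
      coeff (prodP p q (suc n)) (suc k)
        ∎

mainTheorem3 : {c ℓ₁ ℓ₂ : Level} (F : HeytingField c ℓ₁ ℓ₂) →
  let open HeytingField F
      open TDefs F
  in
  (∀ (m : ℕ) → natF (suc m) # 0#) →
  (p q : Carrier) →
  (∀ (n : ℕ) → 1 ≤ n → ∃[ m ] (1 ≤ m × tnum p q n ≈ natF m)) →
  (binomT : ℕ → ℕ → Carrier) →
  (∀ (n k : ℕ) → k ≤ n →
    binomT n k * (tfact p q k * tfact p q (n ∸ k)) ≈ tfact p q n) →
  (∀ (n k : ℕ) → n < k → binomT n k ≈ 0#) →
  ∀ (n : ℕ) → 1 ≤ n → ∀ (k : ℕ) →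
    pow (- 1#) k * pow q (k C 2) * pow p ((n ∸ k) C 2) * binomT n k
      ≈ coeff (prodP p q n) k
mainTheorem3 F char0 p q tnum-positive binomT binomT-spec binomT-above n _ =
  Coefficients.lhs≈coeff-prodP F char0 p q tnum-positive binomT binomT-spec binomT-above n
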